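{- Let $G$ be a finite simple graph and let $M$ be a matching without common neighbors of $G$. Then no cycle of $G$ is an $M$-good cycle, i.e., $G$ has no $M$-alternating cycle.
   Context: A matching is a set of pairwise disjoint edges. For an edge $e$, $I(e)$ is the set of edges other than $e$ sharing a vertex with $e$. A matching $M$ is without common neighbors if $I(e)\cap I(f)=\emptyset$ for all distinct $e,f\in M$. A cycle is $M$-alternating ($M$-good) if of any two consecutive edges of the cycle exactly one belongs to $M$. -}

module Defs where

open import Data.Nat using (ℕ; suc; _≥_)
open import Data.Nat.DivMod using (_mod_)
open import Data.Fin using (Fin; toℕ)
open import Data.Product using (_×_; Σ)
open import Data.Sum using (_⊎_)
open import Relation.Nullary using (¬_)
open import Relation.Binary.PropositionalEquality using (_≡_)
open import Function.Definitions using (Injective)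

record Graph (n : ℕ) : Set₁ where
  field
    Adj    : Fin n → Fin n → Set
    sym    : ∀ {u v} → Adj u v → Adj v u
    irrefl : ∀ {u} → ¬ Adj u u
open Graph public

-- Edges are unordered pairs {a,b}; we present them by ordered pairs and
-- compare them up to swapping.
SameEdge : ∀ {n} → Fin n → Fin n → Fin n → Fin n → Set
SameEdge a b c d = (a ≡ c × b ≡ d) ⊎ (a ≡ d × b ≡ c)

ShareVertex : ∀ {n} → Fin n → Fin n → Fin n → Fin n → Set
ShareVertex a b c d = (a ≡ c ⊎ a ≡ d) ⊎ (b ≡ c ⊎ b ≡ d)

InI : ∀ {n} → Graph n → Fin n → Fin n → Fin n → Fin n → Set
InI G x y a b = Adj G x y × ¬ SameEdge x y a b × ShareVertex x y a b

record EdgeSet {n} (G : Graph n) : Set₁ where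
  field
    In      : Fin n → Fin n → Set
    In-sym  : ∀ {u v} → In u v → In v u
    In-edge : ∀ {u v} → In u v → Adj G u v
open EdgeSet public

IsMatching : ∀ {n} {G : Graph n} → EdgeSet G → Set
IsMatching M = ∀ {a b c d} → In M a b → In M c d → ¬ SameEdge a b c d →
  ¬ ShareVertex a b c d

NoCommonNeighbors : ∀ {n} {G : Graph n} → EdgeSet G → Set
NoCommonNeighbors {G = G} M = ∀ {a b c d} → In M a b → In M c d →
  ¬ SameEdge a b c d → ∀ x y → ¬ (InI G x y a b × InI G x y c d)

next : ∀ {k} → Fin (suc k) → Fin (suc k)
next {k} i = suc (toℕ i) mod (suc k)

record Cycle {n} (G : Graph n) : Set where
  field
    len     : ℕ
    len≥3   : suc len ≥ 3
    vtx     : Fin (suc len) → Fin n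
    vtx-inj : Injective _≡_ _≡_ vtx
    adj     : ∀ i → Adj G (vtx i) (vtx (next i))
open Cycle public

ExactlyOne : Set → Set → Set
ExactlyOne P Q = (P × ¬ Q) ⊎ (¬ P × Q)

IsMGood : ∀ {n} {G : Graph n} → EdgeSet G → Cycle G → Set
IsMGood M C = ∀ i →
  ExactlyOne (In M (vtx C i) (vtx C (next i)))
             (In M (vtx C (next i)) (vtx C (next (next i))))

-- Take an edge e = {v₀, v₁} of the alternating cycle that lies in M. The next
-- edge {v₁, v₂} is not in M and the one after, f = {v₂, v₃}, is again in M.
-- Then {v₁, v₂} belongs to I(e) ∩ I(f), and e ≠ f because the cycle has at
-- least three vertices, so M has common neighbours.
module Submission where

open import Defs hiding (sym)
open import Data.Nat using (ℕ; suc; _+_; _*_; _/_; _<_; NonZero)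
open import Data.Nat.Properties using (+-comm; +-cancelˡ-≡; <-trans; n<1+n)
open import Data.Nat.DivMod using (_%_; m≡m%n+[m/n]*n; m<n⇒m%n≡m; %-distribˡ-+)
open import Data.Nat.Divisibility using (_∣_; divides; >⇒∤)
open import Data.Fin using (Fin; toℕ; zero)
open import Data.Fin.Properties using (toℕ-fromℕ<)
open import Data.Product using (_,_; ∃)
open import Data.Sum using (inj₁; inj₂)
open import Data.Empty using (⊥; ⊥-elim)
open import Relation.Nullary using (¬_)
open import Relation.Binary.PropositionalEquality
  using (_≡_; _≢_; refl; sym; trans; cong; subst; module ≡-Reasoning)

[k+m]%d≡m⇒d∣k : ∀ k m d .{{_ : NonZero d}} → (k + m) % d ≡ m → d ∣ k
[k+m]%d≡m⇒d∣k k m d eq = divides ((k + m) / d) (+-cancelˡ-≡ m k _ m+k≡m+qd)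
  where
  open ≡-Reasoning
  m+k≡m+qd : m + k ≡ m + (k + m) / d * d
  m+k≡m+qd = begin
    m + k                         ≡⟨ +-comm m k ⟩
    k + m                         ≡⟨ m≡m%n+[m/n]*n (k + m) d ⟩
    (k + m) % d + (k + m) / d * d ≡⟨ cong (_+ (k + m) / d * d) eq ⟩
    m + (k + m) / d * d           ∎

module _ {K : ℕ} where

  toℕ-next : (i : Fin (suc K)) → toℕ (next i) ≡ suc (toℕ i) % suc K
  toℕ-next i = toℕ-fromℕ< _

  toℕ-next² : 2 < suc K → (i : Fin (suc K)) →
    toℕ (next (next i)) ≡ (2 + toℕ i) % suc K
  toℕ-next² 2<d i = begin
    toℕ (next (next i))                       ≡⟨ toℕ-next (next i) ⟩
    suc (toℕ (next i)) % suc K                ≡⟨ cong (λ m → suc m % suc K) (toℕ-next i) ⟩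
    (1 + suc (toℕ i) % suc K) % suc K         ≡⟨ cong (λ m → (m + suc (toℕ i) % suc K) % suc K)
                                                    (sym (m<n⇒m%n≡m (<-trans (n<1+n 1) 2<d))) ⟩
    (1 % suc K + suc (toℕ i) % suc K) % suc K ≡⟨ sym (%-distribˡ-+ 1 (suc (toℕ i)) (suc K)) ⟩
    (2 + toℕ i) % suc K                       ∎
    where open ≡-Reasoning

  next²≢id : 2 < suc K → (i : Fin (suc K)) → next (next i) ≢ i
  next²≢id 2<d i nn≡i = >⇒∤ 2<d ([k+m]%d≡m⇒d∣k 2 (toℕ i) (suc K)
    (trans (sym (toℕ-next² 2<d i)) (cong toℕ nn≡i)))

module _ {n : ℕ} {G : Graph n} (M : EdgeSet G) where

  ∉M⇒¬SameEdge : ∀ {x y a b} → ¬ In M x y → In M a b → ¬ SameEdge x y a b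
  ∉M⇒¬SameEdge x∉M ab∈M (inj₁ (refl , refl)) = x∉M ab∈M
  ∉M⇒¬SameEdge x∉M ab∈M (inj₂ (refl , refl)) = x∉M (In-sym M ab∈M)

  ¬alternating-P₄ : NoCommonNeighbors M → ∀ {a b c d} →
    In M a b → Adj G b c → ¬ In M b c → In M c d → a ≢ c → ⊥
  ¬alternating-P₄ ncn {a} {b} {c} {d} ab∈M bc bc∉M cd∈M a≢c = ncn ab∈M cd∈M ab≢cd b c
    ( (bc , ∉M⇒¬SameEdge bc∉M ab∈M , inj₁ (inj₂ refl))
    , (bc , ∉M⇒¬SameEdge bc∉M cd∈M , inj₂ (inj₁ refl)) )
    where
    ab≢cd : ¬ SameEdge a b c d
    ab≢cd (inj₁ (a≡c , _)) = a≢c a≡c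
    ab≢cd (inj₂ (_ , b≡c)) = irrefl G (subst (Adj G _) (sym b≡c) bc)

  module _ (C : Cycle G) where

    InM : Fin (suc (len C)) → Set
    InM i = In M (vtx C i) (vtx C (next i))

    M-good⇒∈M⇒∉M : IsMGood M C → ∀ i → InM i → ¬ InM (next i)
    M-good⇒∈M⇒∉M good i i∈M with good i
    ... | inj₁ (_ , next∉M) = next∉M
    ... | inj₂ (i∉M , _)    = ⊥-elim (i∉M i∈M)

    M-good⇒∉M⇒∈M : IsMGood M C → ∀ i → ¬ InM i → InM (next i)
    M-good⇒∉M⇒∈M good i i∉M with good i
    ... | inj₁ (i∈M , _)    = ⊥-elim (i∉M i∈M)
    ... | inj₂ (_ , next∈M) = next∈M

    M-good⇒∃∈M : IsMGood M C → ∃ InM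
    M-good⇒∃∈M good with good zero
    ... | inj₁ (0∈M , _) = zero , 0∈M
    ... | inj₂ (_ , 1∈M) = next zero , 1∈M

lemma2p4 : (n : ℕ) (G : Graph n) (M : EdgeSet G) →
    IsMatching M → NoCommonNeighbors M →
    (C : Cycle G) → ¬ IsMGood M C
lemma2p4 n G M _ ncn C good with M-good⇒∃∈M M C good
... | i , i∈M = ¬alternating-P₄ M ncn i∈M (adj C (next i)) i+1∉M
                  (M-good⇒∉M⇒∈M M C good (next i) i+1∉M)
                  (λ vᵢ≡vᵢ₊₂ → next²≢id (len≥3 C) i (vtx-inj C (sym vᵢ≡vᵢ₊₂)))
  where
  i+1∉M : ¬ InM M C (next i)
  i+1∉M = M-good⇒∈M⇒∉M M C good i i∈M
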